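{- Let $m$ be a positive integer with $d(m)<4$, where $d(m)$ is the number of positive divisors of $m$ (so $m=1$, $m=p$ or $m=p^2$ with $p$ prime), and suppose $d(m)\in\{2,3\}$. Let $d_1<\cdots<d_{d(m)}$ be the positive divisors of $m$ in increasing order and define the $d(m)\times d(m)$ matrix $A=(A_{ij})$ by $$A_{ij}=\sum_{n=1}^{m/d_j}(d_j n)^{i-1},\qquad 1\le i,j\le d(m).$$ Then $A$ is nonsingular. -}

module Defs where

open import Data.Nat using (ℕ; zero; suc; _+_; _*_; _^_; _/_)
open import Data.Nat.Divisibility using (_∣?_)
open import Data.List using (List; filter; upTo; length; lookup)
open import Data.Fin using (Fin; zero; suc; toℕ; punchIn)
open import Data.Integer as ℤ using (ℤ; +_; -_)

-- Positive divisors of m, in increasing order, each stored as its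
-- predecessor k (the divisor is suc k).  For m ≥ 1 this is [d₁ - 1, …, d_r - 1].
divisorsPred : ℕ → List ℕ
divisorsPred m = filter (λ k → suc k ∣? m) (upTo m)

numDivisors : ℕ → ℕ
numDivisors m = length (divisorsPred m)

divisorAt : (m : ℕ) → Fin (numDivisors m) → ℕ
divisorAt m j = suc (lookup (divisorsPred m) j)

sumFrom1 : ℕ → (ℕ → ℕ) → ℕ
sumFrom1 zero    f = 0
sumFrom1 (suc N) f = sumFrom1 N f + f (suc N)

-- The matrix A, with 0-indexed i, j:
-- A i j = Σ_{n=1}^{m / d_j} (d_j n)^i
matA : (m : ℕ) → Fin (numDivisors m) → Fin (numDivisors m) → ℕ
matA m i j = sumFrom1 (m / suc k) (λ n → (suc k * n) ^ toℕ i)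
  where k = lookup (divisorsPred m) j

det : (n : ℕ) → (Fin n → Fin n → ℤ) → ℤ
det zero    M = + 1
det (suc n) M = go n (λ j → j)
  where
  term : Fin (suc n) → ℤ
  term j = sign (toℕ j) ℤ.* (M zero j ℤ.* det n (λ r c → M (suc r) (punchIn j c)))
    where
    sign : ℕ → ℤ
    sign zero = + 1
    sign (suc zero) = - (+ 1)
    sign (suc (suc k)) = sign k
  go : (k : ℕ) → (Fin (suc k) → Fin (suc n)) → ℤ
  go zero    emb = term (emb zero)
  go (suc k) emb = term (emb zero) ℤ.+ go k (λ x → emb (suc x))

Nonsingular : (n : ℕ) → (Fin n → Fin n → ℕ) → Set
Nonsingular n M = ¬ (det n (λ i j → + (M i j)) ≡ + 0)
  where
  open import Relation.Nullary using (¬_)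
  open import Relation.Binary.PropositionalEquality using (_≡_)

-- The divisors of m are 1, p and, when d(m) = 3, p².  By Faulhaber's formulas the entries of A
-- become polynomials in p once rows 1 and 2 are scaled by 2! and 3!, and the scaled determinant
-- is p(p − 1) for m = p and p⁴(p − 1)³(p + 1) for m = p², nonzero since p ≥ 2.  The divisor
-- list is identified from its characterisation: it is sorted, starts at 1 and ends at m, and
-- when it has three entries the middle one d is its own complement m/d, so m = d².
module Submission where

open import Data.Nat using (ℕ; zero; suc; _≥_)
import Data.Nat as ℕ
open import Data.Integer using (ℤ; +_)
open import Data.Sum using (_⊎_; inj₁; inj₂)
open import Relation.Binary.PropositionalEquality
open import Defs

powerSum : ℕ → ℕ → ℕ → ℕ
powerSum k d N = sumFrom1 N (λ n → (d ℕ.* n) ℕ.^ k)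

module _ (d : ℕ) where
  open import Data.Nat using (_+_; _*_)
  open import Data.Nat.Properties using (+-comm; *-distribˡ-+; *-zeroʳ)
  open import Data.Nat.Tactic.RingSolver using (solve-∀)
  open ≡-Reasoning

  powerSum-0 : ∀ N → powerSum 0 d N ≡ N
  powerSum-0 zero    = refl
  powerSum-0 (suc N) = trans (cong (_+ 1) (powerSum-0 N)) (+-comm N 1)

  powerSum-1 : ∀ N → 2 * powerSum 1 d N ≡ d * N * (N + 1)
  powerSum-1 zero    = cong (_* 1) (sym (*-zeroʳ d))
  powerSum-1 (suc N) = begin
    2 * (powerSum 1 d N + t)         ≡⟨ *-distribˡ-+ 2 (powerSum 1 d N) t ⟩
    2 * powerSum 1 d N + 2 * t       ≡⟨ cong (_+ 2 * t) (powerSum-1 N) ⟩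
    d * N * (N + 1) + 2 * t          ≡⟨ step d N ⟩
    d * suc N * (suc N + 1)          ∎
    where
    t = d * suc N * 1
    step : ∀ d N → d * N * (N + 1) + 2 * (d * suc N * 1) ≡ d * suc N * (suc N + 1)
    step = solve-∀

  powerSum-2 : ∀ N → 6 * powerSum 2 d N ≡ d * d * N * (N + 1) * (2 * N + 1)
  powerSum-2 zero    = cong (λ x → x * 1 * 1) (sym (*-zeroʳ (d * d)))
  powerSum-2 (suc N) = begin
    6 * (powerSum 2 d N + t)                      ≡⟨ *-distribˡ-+ 6 (powerSum 2 d N) t ⟩
    6 * powerSum 2 d N + 6 * t                    ≡⟨ cong (_+ 6 * t) (powerSum-2 N) ⟩
    d * d * N * (N + 1) * (2 * N + 1) + 6 * t     ≡⟨ step d N ⟩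
    d * d * suc N * (suc N + 1) * (2 * suc N + 1) ∎
    where
    t = d * suc N * (d * suc N * 1)
    step : ∀ d N → d * d * N * (N + 1) * (2 * N + 1) + 6 * (d * suc N * (d * suc N * 1))
                 ≡ d * d * suc N * (suc N + 1) * (2 * suc N + 1)
    step = solve-∀

module _ where
  open import Data.Integer using (_+_; _*_)

  faulhaber₁ faulhaber₂ : ℤ → ℤ → ℤ
  faulhaber₁ d N = d * N * (N + + 1)
  faulhaber₂ d N = d * d * N * (N + + 1) * (+ 2 * N + + 1)

module _ (d N : ℕ) where
  open import Data.Integer using (_+_; _*_)
  open import Data.Integer.Properties using (pos-*; pos-+)

  +powerSum-0 : + powerSum 0 d N ≡ + N
  +powerSum-0 = cong +_ (powerSum-0 d N)

  +powerSum-1 : + 2 * + powerSum 1 d N ≡ faulhaber₁ (+ d) (+ N)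
  +powerSum-1 = trans (sym (pos-* 2 (powerSum 1 d N))) (trans (cong +_ (powerSum-1 d N))
    (trans (pos-* (d ℕ.* N) _) (cong₂ _*_ (pos-* d N) (pos-+ N 1))))

  +powerSum-2 : + 6 * + powerSum 2 d N ≡ faulhaber₂ (+ d) (+ N)
  +powerSum-2 = trans (sym (pos-* 6 (powerSum 2 d N))) (trans (cong +_ (powerSum-2 d N))
    (trans (pos-* (d ℕ.* d ℕ.* N ℕ.* (N ℕ.+ 1)) _) (cong₂ _*_
      (trans (pos-* (d ℕ.* d ℕ.* N) _) (cong₂ _*_
        (trans (pos-* (d ℕ.* d) N) (cong (_* + N) (pos-* d d))) (pos-+ N 1)))
      (trans (pos-+ (2 ℕ.* N) 1) (cong (_+ + 1) (pos-* 2 N))))))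

-- The ring solver does not unfold definitions, so each identity about det₂ and det₃ is proved
-- by a helper whose statement spells the determinant out.
module _ where
  open import Data.Integer using (_+_; _*_; _-_; -_)
  open import Data.Integer.Tactic.RingSolver using (solve-∀)
  open import Data.Fin using (Fin; suc; punchIn; #_)
  open import Function.Nary.NonDependent using (congₙ)

  det₂ : ℤ → ℤ → ℤ → ℤ → ℤ
  det₂ a b c d = a * d - b * c

  det₃ : ℤ → ℤ → ℤ → ℤ → ℤ → ℤ → ℤ → ℤ → ℤ → ℤ
  det₃ a b c d e f g h i = a * det₂ e f h i - b * det₂ d f g i + c * det₂ d e g h

  det-2×2 : (M : Fin 2 → Fin 2 → ℤ) → det 2 M ≡ det₂ (M (# 0) (# 0)) (M (# 0) (# 1)) (M (# 1) (# 0)) (M (# 1) (# 1))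
  det-2×2 M = laplace (M (# 0) (# 0)) (M (# 0) (# 1)) (M (# 1) (# 0)) (M (# 1) (# 1))
    where
    laplace : ∀ a b c d → + 1 * (a * (+ 1 * (d * + 1))) + - + 1 * (b * (+ 1 * (c * + 1))) ≡ a * d - b * c
    laplace = solve-∀

  det-3×3 : (M : Fin 3 → Fin 3 → ℤ) →
            det 3 M ≡ det₃ (M (# 0) (# 0)) (M (# 0) (# 1)) (M (# 0) (# 2))
                           (M (# 1) (# 0)) (M (# 1) (# 1)) (M (# 1) (# 2))
                           (M (# 2) (# 0)) (M (# 2) (# 1)) (M (# 2) (# 2))
  det-3×3 M = trans (laplace (M (# 0) (# 0)) (M (# 0) (# 1)) (M (# 0) (# 2))
                             (det 2 (minor (# 0))) (det 2 (minor (# 1))) (det 2 (minor (# 2))))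
                    (congₙ 3 (λ x y z → M (# 0) (# 0) * x - M (# 0) (# 1) * y + M (# 0) (# 2) * z)
                             (det-2×2 (minor (# 0))) (det-2×2 (minor (# 1))) (det-2×2 (minor (# 2))))
    where
    minor : Fin 3 → Fin 2 → Fin 2 → ℤ
    minor j r c = M (suc r) (punchIn j c)
    laplace : ∀ a b c x y z → + 1 * (a * x) + (- + 1 * (b * y) + + 1 * (c * z)) ≡ a * x - b * y + c * z
    laplace = solve-∀

  det₂-scaleRow : ∀ s a b c d → s * det₂ a b c d ≡ det₂ a b (s * c) (s * d)
  det₂-scaleRow = expanded
    where
    expanded : ∀ s a b c d → s * (a * d - b * c) ≡ a * (s * d) - b * (s * c)
    expanded = solve-∀

  det₃-scaleRows : ∀ r s a b c d e f g h i →
                   r * s * det₃ a b c d e f g h i ≡ det₃ a b c (r * d) (r * e) (r * f) (s * g) (s * h) (s * i)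
  det₃-scaleRows = expanded
    where
    expanded : ∀ r s a b c d e f g h i →
               r * s * (a * (e * i - f * h) - b * (d * i - f * g) + c * (d * h - e * g))
               ≡ a * (r * e * (s * i) - r * f * (s * h)) - b * (r * d * (s * i) - r * f * (s * g))
                 + c * (r * d * (s * h) - r * e * (s * g))
    expanded = solve-∀

  det-2×2-scaleRow : ∀ s (M : Fin 2 → Fin 2 → ℤ) →
    s * det 2 M ≡ det₂ (M (# 0) (# 0)) (M (# 0) (# 1)) (s * M (# 1) (# 0)) (s * M (# 1) (# 1))
  det-2×2-scaleRow s M = trans (cong (s *_) (det-2×2 M))
    (det₂-scaleRow s (M (# 0) (# 0)) (M (# 0) (# 1)) (M (# 1) (# 0)) (M (# 1) (# 1)))

  det-3×3-scaleRows : ∀ r s (M : Fin 3 → Fin 3 → ℤ) →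
    r * s * det 3 M ≡ det₃ (M (# 0) (# 0)) (M (# 0) (# 1)) (M (# 0) (# 2))
                           (r * M (# 1) (# 0)) (r * M (# 1) (# 1)) (r * M (# 1) (# 2))
                           (s * M (# 2) (# 0)) (s * M (# 2) (# 1)) (s * M (# 2) (# 2))
  det-3×3-scaleRows r s M = trans (cong (r * s *_) (det-3×3 M))
    (det₃-scaleRows r s (M (# 0) (# 0)) (M (# 0) (# 1)) (M (# 0) (# 2))
                        (M (# 1) (# 0)) (M (# 1) (# 1)) (M (# 1) (# 2))
                        (M (# 2) (# 0)) (M (# 2) (# 1)) (M (# 2) (# 2)))

module _ where
  open import Data.Nat using (_≤_; s≤s)
  open import Data.Integer using (_+_; _*_; _-_)
  open import Data.Integer.Properties using (pos-*)
  open import Data.Integer.Tactic.RingSolver using (solve-∀)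
  open import Data.Fin using (Fin; toℕ)
  open import Data.Vec using (Vec; []; _∷_; lookup)
  open import Function.Nary.NonDependent using (congₙ)
  open ≡-Reasoning

  powerSumMatrix : ∀ {n} → Vec ℕ n → Vec ℕ n → Fin n → Fin n → ℕ
  powerSumMatrix ds Ns i j = powerSum (toℕ i) (lookup ds j) (lookup Ns j)

  powerSumMatrix₂-det : ∀ p →
    + 2 * det 2 (λ i j → + powerSumMatrix (1 ∷ p ∷ []) (p ∷ 1 ∷ []) i j) ≡ + p * (+ p - + 1)
  powerSumMatrix₂-det p = begin
    + 2 * det 2 M
      ≡⟨ det-2×2-scaleRow (+ 2) M ⟩
    det₂ (+ powerSum 0 1 p) (+ powerSum 0 p 1) (+ 2 * + powerSum 1 1 p) (+ 2 * + powerSum 1 p 1)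
      ≡⟨ congₙ 4 det₂ (+powerSum-0 1 p) (+powerSum-0 p 1) (+powerSum-1 1 p) (+powerSum-1 p 1) ⟩
    det₂ (+ p) (+ 1) (faulhaber₁ (+ 1) (+ p)) (faulhaber₁ (+ p) (+ 1))
      ≡⟨ expanded (+ p) ⟩
    + p * (+ p - + 1) ∎
    where
    M = λ i j → + powerSumMatrix (1 ∷ p ∷ []) (p ∷ 1 ∷ []) i j
    expanded : ∀ P → P * (P * + 1 * (+ 1 + + 1)) - + 1 * (+ 1 * P * (P + + 1)) ≡ P * (P - + 1)
    expanded = solve-∀

  powerSumMatrix₃-det : ∀ p → let q = p ℕ.* p in
    + 12 * det 3 (λ i j → + powerSumMatrix (1 ∷ p ∷ q ∷ []) (q ∷ p ∷ 1 ∷ []) i j)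
    ≡ + p * + p * + p * + p * (+ p - + 1) * (+ p - + 1) * (+ p - + 1) * (+ p + + 1)
  powerSumMatrix₃-det p = begin
    + 12 * det 3 M
      ≡⟨ det-3×3-scaleRows (+ 2) (+ 6) M ⟩
    det₃ (+ powerSum 0 1 q) (+ powerSum 0 p p) (+ powerSum 0 q 1)
         (+ 2 * + powerSum 1 1 q) (+ 2 * + powerSum 1 p p) (+ 2 * + powerSum 1 q 1)
         (+ 6 * + powerSum 2 1 q) (+ 6 * + powerSum 2 p p) (+ 6 * + powerSum 2 q 1)
      ≡⟨ congₙ 9 det₃ (+powerSum-0 1 q) (+powerSum-0 p p) (+powerSum-0 q 1)
                      (+powerSum-1 1 q) (+powerSum-1 p p) (+powerSum-1 q 1)
                      (+powerSum-2 1 q) (+powerSum-2 p p) (+powerSum-2 q 1) ⟩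
    det₃ (+ q) (+ p) (+ 1)
         (faulhaber₁ (+ 1) (+ q)) (faulhaber₁ (+ p) (+ p)) (faulhaber₁ (+ q) (+ 1))
         (faulhaber₂ (+ 1) (+ q)) (faulhaber₂ (+ p) (+ p)) (faulhaber₂ (+ q) (+ 1))
      ≡⟨ evaluate (+ p) (+ q) (pos-* p p) ⟩
    + p * + p * + p * + p * (+ p - + 1) * (+ p - + 1) * (+ p - + 1) * (+ p + + 1) ∎
    where
    q = p ℕ.* p
    M = λ i j → + powerSumMatrix (1 ∷ p ∷ q ∷ []) (q ∷ p ∷ 1 ∷ []) i j
    expanded : ∀ P →
      let Q = P * P
          a = Q ; b = P ; c = + 1
          d = + 1 * Q * (Q + + 1) ; e = P * P * (P + + 1) ; f = Q * + 1 * (+ 1 + + 1)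
          g = + 1 * + 1 * Q * (Q + + 1) * (+ 2 * Q + + 1)
          h = P * P * P * (P + + 1) * (+ 2 * P + + 1)
          i = Q * Q * + 1 * (+ 1 + + 1) * (+ 2 * + 1 + + 1)
      in a * (e * i - f * h) - b * (d * i - f * g) + c * (d * h - e * g)
         ≡ P * P * P * P * (P - + 1) * (P - + 1) * (P - + 1) * (P + + 1)
    expanded = solve-∀
    evaluate : ∀ P Q → Q ≡ P * P →
      det₃ Q P (+ 1)
           (faulhaber₁ (+ 1) Q) (faulhaber₁ P P) (faulhaber₁ Q (+ 1))
           (faulhaber₂ (+ 1) Q) (faulhaber₂ P P) (faulhaber₂ Q (+ 1))
      ≡ P * P * P * P * (P - + 1) * (P - + 1) * (P - + 1) * (P + + 1)
    evaluate P _ refl = expanded P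

  -- With p = 2 + c every factor of the value of the determinant computes to a positive integer.
  powerSumMatrix₂-nonsingular : ∀ {p} → 2 ≤ p → Nonsingular 2 (powerSumMatrix (1 ∷ p ∷ []) (p ∷ 1 ∷ []))
  powerSumMatrix₂-nonsingular {suc (suc c)} (s≤s (s≤s _)) det≡0 =
    value≢0 (trans (sym (powerSumMatrix₂-det (suc (suc c)))) (cong (+ 2 *_) det≡0))
    where
    P = + suc (suc c)
    value≢0 : P * (P - + 1) ≢ + 0
    value≢0 ()

  powerSumMatrix₃-nonsingular : ∀ {p} → 2 ≤ p →
    Nonsingular 3 (powerSumMatrix (1 ∷ p ∷ p ℕ.* p ∷ []) (p ℕ.* p ∷ p ∷ 1 ∷ []))
  powerSumMatrix₃-nonsingular {suc (suc c)} (s≤s (s≤s _)) det≡0 =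
    value≢0 (trans (sym (powerSumMatrix₃-det (suc (suc c)))) (cong (+ 12 *_) det≡0))
    where
    P = + suc (suc c)
    value≢0 : P * P * P * P * (P - + 1) * (P - + 1) * (P - + 1) * (P + + 1) ≢ + 0
    value≢0 ()

module _ where
  open import Data.Nat using (_*_; _<_; _≤_; _/_; s≤s; z<s; n>1⇒nonTrivial)
  open import Data.Nat.Properties using (≤-refl; <⇒≤; ≤-antisym; ≤-pred; n≤0⇒n≡0; m<n⇒m<1+n; <⇒≢; >⇒≢)
  open import Data.Nat.Divisibility using (_∣_; _∣?_; divides; ∣-refl; 1∣_; quotient>1; quotient-<; quotient-∣)
  open import Data.Nat.DivMod using (n/1≡n; n/n≡1; m*n/n≡m)
  open import Data.List using (List; []; _∷_; _∷ʳ_; length; upTo)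
  import Data.List as List
  open import Data.List.Membership.Propositional using (_∈_)
  open import Data.List.Membership.Propositional.Properties
    using (∈-filter⁺; ∈-filter⁻; ∈-upTo⁺; ∈-upTo⁻; ∈-++⁺ʳ)
  open import Data.List.Relation.Unary.Any using (here; there)
  open import Data.List.Relation.Unary.All as All using ([]; _∷_)
  open import Data.List.Relation.Unary.AllPairs using (AllPairs; []; _∷_)
  import Data.List.Relation.Unary.AllPairs.Properties as AllPairs
  open import Data.Fin using (Fin; toℕ)
  open import Data.Vec using ([]; _∷_)
  open import Data.Product using (proj₁; proj₂)
  open import Function using (id)
  open import Function.Nary.NonDependent using (congₙ)
  open import Relation.Nullary using (contradiction)

  head-≤ : ∀ {x v xs} → AllPairs _<_ (x ∷ xs) → v ∈ x ∷ xs → x ≤ v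
  head-≤ _          (here refl)  = ≤-refl
  head-≤ (x<xs ∷ _) (there v∈xs) = <⇒≤ (All.lookup x<xs v∈xs)

  last-≥ : ∀ {y v} xs → AllPairs _<_ (xs ∷ʳ y) → v ∈ xs ∷ʳ y → v ≤ y
  last-≥ []       _            (here refl) = ≤-refl
  last-≥ (x ∷ xs) (x<xs ∷ _)   (here refl) = <⇒≤ (All.lookup x<xs (∈-++⁺ʳ xs (here refl)))
  last-≥ (x ∷ xs) (_ ∷ sorted) (there v∈)  = last-≥ xs sorted v∈

  record IsDivisorEnumeration (n : ℕ) (ks : List ℕ) : Set where
    field
      ∈⇒<    : ∀ {k} → k ∈ ks → k < n
      ∈⇒∣    : ∀ {k} → k ∈ ks → suc k ∣ n
      ∣⇒∈    : ∀ {k} → k < n → suc k ∣ n → k ∈ ks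
      sorted : AllPairs _<_ ks

  open IsDivisorEnumeration

  divisorsPred-isDivisorEnumeration : ∀ n → IsDivisorEnumeration n (divisorsPred n)
  divisorsPred-isDivisorEnumeration n = record
    { ∈⇒<    = λ k∈ → ∈-upTo⁻ (proj₁ (∈-filter⁻ divides? {xs = upTo n} k∈))
    ; ∈⇒∣    = λ k∈ → proj₂ (∈-filter⁻ divides? {xs = upTo n} k∈)
    ; ∣⇒∈    = λ k<n k∣n → ∈-filter⁺ divides? (∈-upTo⁺ k<n) k∣n
    ; sorted = AllPairs.filter⁺ divides? (AllPairs.applyUpTo⁺₁ id n (λ i<j _ → i<j))
    }
    where
    divides? = λ k → suc k ∣? n

  module _ {m : ℕ} where

    head≡0 : ∀ {x xs} → IsDivisorEnumeration (suc m) (x ∷ xs) → x ≡ 0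
    head≡0 e = n≤0⇒n≡0 (head-≤ (sorted e) (∣⇒∈ e z<s (1∣ _)))

    last≡pred : ∀ {y} xs → IsDivisorEnumeration (suc m) (xs ∷ʳ y) → y ≡ m
    last≡pred xs e = ≤-antisym (≤-pred (∈⇒< e (∈-++⁺ʳ xs (here refl))))
                               (last-≥ xs (sorted e) (∣⇒∈ e ≤-refl ∣-refl))

    middle-unique : ∀ {x y z k} → IsDivisorEnumeration (suc m) (x ∷ y ∷ z ∷ []) →
                    0 < k → k < m → suc k ∣ suc m → k ≡ y
    middle-unique e 0<k k<m k∣ with ∣⇒∈ e (m<n⇒m<1+n k<m) k∣
    ... | here k≡x                 = contradiction (trans k≡x (head≡0 e)) (>⇒≢ 0<k)
    ... | there (here k≡y)         = k≡y
    ... | there (there (here k≡z)) = contradiction (trans k≡z (last≡pred (_ ∷ _ ∷ []) e)) (<⇒≢ k<m)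

    -- The middle divisor d of suc m is strictly between 1 and suc m, hence so is suc m / d.
    middle-squared : ∀ {x y z} → IsDivisorEnumeration (suc m) (x ∷ y ∷ z ∷ []) → suc m ≡ suc y * suc y
    middle-squared {x} {y} e with sorted e | head≡0 e | last≡pred (x ∷ y ∷ []) e | ∈⇒∣ e (there (here refl))
    ... | (0<y ∷ _) ∷ (y<m ∷ []) ∷ [] ∷ [] | refl | refl | y∣@(divides (suc k) m≡) =
      trans m≡ (cong (λ k → suc k * suc y) k≡y)
      where
      k≡y : k ≡ y
      k≡y = middle-unique e (≤-pred (quotient>1 y∣ (s≤s y<m)))
                            (≤-pred (quotient-< y∣ {{n>1⇒nonTrivial (s≤s 0<y)}}))
                            (quotient-∣ y∣)
    ... | _ | _ | _ | divides zero ()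

  divisorMatrix : (n : ℕ) (ks : List ℕ) → Fin (length ks) → Fin (length ks) → ℕ
  divisorMatrix n ks i j = powerSum (toℕ i) (suc (List.lookup ks j)) (n / suc (List.lookup ks j))

  module _ {m : ℕ} where

    divisorMatrix₂-nonsingular : ∀ {x y} → IsDivisorEnumeration (suc m) (x ∷ y ∷ []) →
                                      Nonsingular 2 (divisorMatrix (suc m) (x ∷ y ∷ []))
    divisorMatrix₂-nonsingular e with sorted e | head≡0 e | last≡pred (_ ∷ []) e
    ... | (0<m ∷ []) ∷ [] ∷ [] | refl | refl =
      subst (λ Ns → Nonsingular 2 (powerSumMatrix (1 ∷ suc m ∷ []) Ns))
            (congₙ 2 (λ a b → a ∷ b ∷ []) (sym (n/1≡n (suc m))) (sym (n/n≡1 (suc m))))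
            (powerSumMatrix₂-nonsingular (s≤s 0<m))

    divisorMatrix₃-nonsingular : ∀ {x y z} → IsDivisorEnumeration (suc m) (x ∷ y ∷ z ∷ []) →
                                            Nonsingular 3 (divisorMatrix (suc m) (x ∷ y ∷ z ∷ []))
    divisorMatrix₃-nonsingular {y = y} e with sorted e | head≡0 e | last≡pred (_ ∷ _ ∷ []) e
    ... | (0<y ∷ _) ∷ _ | refl | refl =
      subst₂ (λ ds Ns → Nonsingular 3 (powerSumMatrix ds Ns))
             (cong (λ d → 1 ∷ suc y ∷ d ∷ []) (sym m≡y²))
             (congₙ 3 (λ a b c → a ∷ b ∷ c ∷ [])
                      (sym (trans (n/1≡n (suc m)) m≡y²))
                      (sym (trans (cong (_/ suc y) m≡y²) (m*n/n≡m (suc y) (suc y))))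
                      (sym (n/n≡1 (suc m))))
             (powerSumMatrix₃-nonsingular (s≤s 0<y))
      where
      m≡y² : suc m ≡ suc y * suc y
      m≡y² = middle-squared e

  divisorMatrix-nonsingular : ∀ {m} ks → IsDivisorEnumeration (suc m) ks →
    length ks ≡ 2 ⊎ length ks ≡ 3 → Nonsingular (length ks) (divisorMatrix (suc m) ks)
  divisorMatrix-nonsingular (_ ∷ _ ∷ [])         e (inj₁ refl) = divisorMatrix₂-nonsingular e
  divisorMatrix-nonsingular (_ ∷ _ ∷ _ ∷ [])     e (inj₂ refl) = divisorMatrix₃-nonsingular e
  divisorMatrix-nonsingular []                   _ (inj₁ ())
  divisorMatrix-nonsingular []                   _ (inj₂ ())
  divisorMatrix-nonsingular (_ ∷ [])             _ (inj₁ ())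
  divisorMatrix-nonsingular (_ ∷ [])             _ (inj₂ ())
  divisorMatrix-nonsingular (_ ∷ _ ∷ [])         _ (inj₂ ())
  divisorMatrix-nonsingular (_ ∷ _ ∷ _ ∷ [])     _ (inj₁ ())
  divisorMatrix-nonsingular (_ ∷ _ ∷ _ ∷ _ ∷ _) _ (inj₁ ())
  divisorMatrix-nonsingular (_ ∷ _ ∷ _ ∷ _ ∷ _) _ (inj₂ ())

mainTheorem3 : (m : ℕ) → m ≥ 1 → (numDivisors m ≡ 2 ⊎ numDivisors m ≡ 3) → Nonsingular (numDivisors m) (matA m)
mainTheorem3 (suc m) _ two-or-three =
  divisorMatrix-nonsingular (divisorsPred (suc m)) (divisorsPred-isDivisorEnumeration (suc m)) two-or-three
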